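{- Let $A\to X$ and $B\to Y$ be cofibrations of digraphs such that some vertex of $X$ not in $A$ admits a path to a vertex of $A$, and some vertex of $Y$ not in $B$ admits a path to a vertex of $B$. Then the pushout box product map $X\mathbin{\square}B\cup_{A\mathbin{\square}B}A\mathbin{\square}Y\to X\mathbin{\square}Y$ is not a cofibration.
   Context: A digraph $X$ is a set $X_V$ with a reflexive binary relation ($x\to y$ an edge); maps preserve the relation. Induced subgraph $A\subseteq X$: for $a,b\in A_V$, $a\to b$ in $A$ iff in $X$. Path of length $n$: $v_0\to\dots\to v_n$. $X^A$: induced subgraph on vertices admitting a path to some vertex of $A$. A projecting decomposition of $X$ w.r.t. $A$: $\pi\colon X^A_V\to A_V$ such that for any $x\in X_V$ and $a\in A_V$ admitting a path from $x$, some minimal-length path from $x$ to $a$ passes through $\pi x$. A cofibration: an induced subgraph inclusion $A\to X$ with no edges from vertices of $A$ to vertices outside $A$, such that $X$ admits a projecting decomposition w.r.t. $A$. The box product $X\mathbin{\square}Y$ has vertices $X_V\times Y_V$ and an edge $(x,x')\to(y,y')$ iff ($x\to y$ in $X$ and $x'=y'$) or ($x'\to y'$ in $Y$ and $x=y$). The pushout $X\mathbin{\square}B\cup_{A\mathbin{\square}B}A\mathbin{\square}Y$ (in $\mathsf{DiGraph}$) maps to $X\mathbin{\square}Y$ via the inclusions of $X\mathbin{\square}B$ and $A\mathbin{\square}Y$. -}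

module Defs where

open import Data.Nat using (ℕ; zero; suc; _≤_)
open import Data.Bool using (Bool; true; false; T; _∨_)
open import Data.Unit using (⊤; tt)
open import Data.Empty using (⊥; ⊥-elim)
open import Data.Product using (Σ; _×_; _,_; proj₁; proj₂; ∃)
open import Data.Sum using (_⊎_; inj₁; inj₂)
open import Relation.Nullary using (¬_)
open import Relation.Binary.PropositionalEquality using (_≡_; refl)

record DiGraph : Set₁ where
  field
    V    : Set
    E    : V → V → Set
    E-refl : ∀ x → E x x
open DiGraph public

record Hom (G H : DiGraph) : Set where
  field
    fun  : V G → V H
    pres : ∀ {x y} → E G x y → E H (fun x) (fun y)
open Hom public

data Path (G : DiGraph) : ℕ → V G → V G → Set where
  nil  : ∀ {x} → Path G 0 x x
  cons : ∀ {n x y z} → E G x y → Path G n y z → Path G (suc n) x z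

PassesThrough : ∀ {G n x y} → V G → Path G n x y → Set
PassesThrough {x = x} v nil = v ≡ x
PassesThrough {x = x} v (cons e p) = (v ≡ x) ⊎ PassesThrough v p

Minimal : ∀ {G n x y} → Path G n x y → Set
Minimal {G} {n} {x} {y} p = ∀ m → Path G m x y → n ≤ m

Reaches : (G : DiGraph) → (V G → Set) → V G → Set
Reaches G P x = Σ (V G) λ a → P a × Σ ℕ λ n → Path G n x a

-- Projecting decomposition of G w.r.t. the induced subgraph on P.
-- π is given as a total function on V G, required to land in P on the
-- vertices of G^P (its values elsewhere are irrelevant).
ProjectingDecomposition : (G : DiGraph) → (V G → Set) → Set
ProjectingDecomposition G P =
  Σ (V G → V G) λ π →
    (∀ x → Reaches G P x → P (π x)) ×
    (∀ x a n → P a → Path G n x a →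
       Σ ℕ λ m → Σ (Path G m x a) λ q → Minimal q × PassesThrough (π x) q)

IsCofibrationSub : (G : DiGraph) → (V G → Set) → Set
IsCofibrationSub G P =
  (∀ x y → E G x y → P x → P y) × ProjectingDecomposition G P

Image : ∀ {G H} → Hom G H → V H → Set
Image {G} f h = Σ (V G) λ g → fun f g ≡ h

-- A map is a cofibration: it is an induced subgraph inclusion (injective on
-- vertices, reflecting edges) whose image is a cofibration subgraph.
IsCofibration : ∀ {G H} → Hom G H → Set
IsCofibration {G} {H} f =
  (∀ x y → fun f x ≡ fun f y → x ≡ y) ×
  (∀ x y → E H (fun f x) (fun f y) → E G x y) ×
  IsCofibrationSub H (Image f)

BoxE : (X Y : DiGraph) → V X × V Y → V X × V Y → Set
BoxE X Y (x , x') (y , y') = (E X x y × x' ≡ y') ⊎ (E Y x' y' × x ≡ y)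

_□_ : DiGraph → DiGraph → DiGraph
X □ Y = record
  { V = V X × V Y
  ; E = BoxE X Y
  ; E-refl = λ { (x , y) → inj₁ (DiGraph.E-refl X x , refl) } }

-- The pushout X □ B ∪_{A □ B} A □ Y, for induced subgraphs A ⊆ X, B ⊆ Y
-- given by (classical, Bool-valued) characteristic functions.
-- Concretely: the union of X □ B and A □ Y inside V X × V Y, with edge set
-- the union of the edge sets of X □ B and A □ Y.
PushoutV : (X Y : DiGraph) → (V X → Bool) → (V Y → Bool) → Set
PushoutV X Y A B = Σ (V X × V Y) λ p → T (A (proj₁ p) ∨ B (proj₂ p))

PushoutE : (X Y : DiGraph) (A : V X → Bool) (B : V Y → Bool) →
           PushoutV X Y A B → PushoutV X Y A B → Set
PushoutE X Y A B ((x , x') , _) ((y , y') , _) =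
  (T (B x') × T (B y') × BoxE X Y (x , x') (y , y')) ⊎
  (T (A x) × T (A y) × BoxE X Y (x , x') (y , y'))

private
  pushoutRefl : (X Y : DiGraph) (A : V X → Bool) (B : V Y → Bool) →
                ∀ v → PushoutE X Y A B v v
  pushoutRefl X Y A B ((x , y) , t) with A x | B y
  ... | true  | b     = inj₂ (tt , tt , inj₁ (DiGraph.E-refl X x , refl))
  ... | false | true  = inj₁ (tt , tt , inj₁ (DiGraph.E-refl X x , refl))
  ... | false | false = ⊥-elim t

Pushout : (X Y : DiGraph) → (V X → Bool) → (V Y → Bool) → DiGraph
Pushout X Y A B = record
  { V = PushoutV X Y A B
  ; E = PushoutE X Y A B
  ; E-refl = pushoutRefl X Y A B }

pushoutMap : (X Y : DiGraph) (A : V X → Bool) (B : V Y → Bool) →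
             Hom (Pushout X Y A B) (X □ Y)
pushoutMap X Y A B = record
  { fun = proj₁
  ; pres = λ { (inj₁ (_ , _ , e)) → e ; (inj₂ (_ , _ , e)) → e } }

{-# OPTIONS --safe #-}
module Submission where

-- Pick x₁ ∉ A with an edge x₁ → a into A and y₁ ∉ B with an edge y₁ → b into B
-- (they exist on any path from outside into the subgraph). The corner (x₁ , y₁)
-- lies outside the pushout but has edges to (a , y₁) and (x₁ , b) inside it. A
-- minimal path along an edge has length one, so a projecting decomposition must
-- send the corner to both neighbours at once, forcing a ≡ x₁.

open import Defs
open import Data.Bool using (Bool; T; T?)
open import Data.Bool.Properties using (T-∨)
open import Data.Nat using (s≤s)
open import Data.Product using (Σ; _×_; _,_; proj₁)
open import Data.Sum using (_⊎_; inj₁; inj₂)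
open import Function.Bundles using (Equivalence)
open import Relation.Nullary using (¬_; yes; no; contradiction)
open import Relation.Unary using (Decidable)
open import Relation.Binary.PropositionalEquality using (_≡_; refl; sym; trans; cong; subst)

IncomingEdge : (G : DiGraph) → (V G → Set) → Set
IncomingEdge G P = Σ (V G) λ x → Σ (V G) λ a → ¬ P x × P a × E G x a

path-incomingEdge : ∀ {G P} → Decidable P → ∀ {n x a} →
                    ¬ P x → P a → Path G n x a → IncomingEdge G P
path-incomingEdge P? ¬Px Pa nil = contradiction Pa ¬Px
path-incomingEdge P? ¬Px Pa (cons {y = y} x→y p) with P? y
... | yes Py  = _ , y , ¬Px , Py , x→y
... | no  ¬Py = path-incomingEdge P? ¬Py Pa p

reaches-incomingEdge : ∀ {G P} → Decidable P → ∀ {x} →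
                       ¬ P x → Reaches G P x → IncomingEdge G P
reaches-incomingEdge P? ¬Px (_ , Pa , _ , p) = path-incomingEdge P? ¬Px Pa p

passesThrough-minimal-edge : ∀ {G m s t v} → E G s t →
                             (q : Path G m s t) → Minimal q → PassesThrough v q →
                             v ≡ s ⊎ v ≡ t
passesThrough-minimal-edge _ nil _ v≡s = inj₁ v≡s
passesThrough-minimal-edge _ (cons _ nil) _ (inj₁ v≡s) = inj₁ v≡s
passesThrough-minimal-edge _ (cons _ nil) _ (inj₂ v≡t) = inj₂ v≡t
passesThrough-minimal-edge s→t (cons _ (cons _ _)) minimal _
  with minimal 1 (cons s→t nil)
... | s≤s ()

projection-incomingEdge : ∀ {G P} (π : ProjectingDecomposition G P) {s t} →
                          ¬ P s → P t → E G s t → proj₁ π s ≡ t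
projection-incomingEdge {P = P} (π , π∈P , throughπ) {s} {t} ¬Ps Pt s→t
  with throughπ s t 1 Pt (cons s→t nil)
... | _ , q , minimal , πs∈q with passesThrough-minimal-edge s→t q minimal πs∈q
...   | inj₂ πs≡t = πs≡t
...   | inj₁ πs≡s = contradiction (subst P πs≡s (π∈P s (t , Pt , 1 , cons s→t nil))) ¬Ps

module _ (X Y : DiGraph) (A : V X → Bool) (B : V Y → Bool) where

  image-pushoutMap : ∀ {x y} → T (A x) ⊎ T (B y) → Image (pushoutMap X Y A B) (x , y)
  image-pushoutMap {x} {y} x∈A⊎y∈B = ((x , y) , Equivalence.from T-∨ x∈A⊎y∈B) , refl

  ∉-image-pushoutMap : ∀ {x y} → ¬ T (A x) → ¬ T (B y) →
                       ¬ Image (pushoutMap X Y A B) (x , y)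
  ∉-image-pushoutMap x∉A y∉B ((_ , x∈A∨y∈B) , refl) with Equivalence.to T-∨ x∈A∨y∈B
  ... | inj₁ x∈A = x∉A x∈A
  ... | inj₂ y∈B = y∉B y∈B

proposition2p14 : (X Y : DiGraph) (A : V X → Bool) (B : V Y → Bool) →
    IsCofibrationSub X (λ x → T (A x)) →
    IsCofibrationSub Y (λ y → T (B y)) →
    Σ (V X) (λ x → ¬ T (A x) × Reaches X (λ a → T (A a)) x) →
    Σ (V Y) (λ y → ¬ T (B y) × Reaches Y (λ b → T (B b)) y) →
    ¬ IsCofibration (pushoutMap X Y A B)
proposition2p14 X Y A B _ _ (_ , x∉A , x⇝A) (_ , y∉B , y⇝B) (_ , _ , _ , π)
  with reaches-incomingEdge (λ x → T? (A x)) x∉A x⇝A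
     | reaches-incomingEdge (λ y → T? (B y)) y∉B y⇝B
... | x₁ , a , x₁∉A , a∈A , x₁→a | y₁ , b , y₁∉B , b∈B , y₁→b =
  x₁∉A (subst (λ x → T (A x)) a≡x₁ a∈A)
  where
  corner∉ : ¬ Image (pushoutMap X Y A B) (x₁ , y₁)
  corner∉ = ∉-image-pushoutMap X Y A B x₁∉A y₁∉B

  π-corner≡a : proj₁ π (x₁ , y₁) ≡ (a , y₁)
  π-corner≡a = projection-incomingEdge π corner∉
    (image-pushoutMap X Y A B (inj₁ a∈A)) (inj₁ (x₁→a , refl))

  π-corner≡b : proj₁ π (x₁ , y₁) ≡ (x₁ , b)
  π-corner≡b = projection-incomingEdge π corner∉
    (image-pushoutMap X Y A B (inj₂ b∈B)) (inj₂ (y₁→b , refl))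

  a≡x₁ : a ≡ x₁
  a≡x₁ = cong proj₁ (trans (sym π-corner≡a) π-corner≡b)
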